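{- Let $T$ be a tree such that either the red edges of $T$ induce a path, or $T$ has no red edge and has a vertex whose closed neighbourhood contains all branch vertices of $T$. Let $A$ be an extended red path of $T$. Then every branch vertex of $T$ is either a red vertex (a vertex of $A$) or is adjacent to a red vertex.
   Context: A branch vertex is a vertex of degree greater than $2$. A claw is $K_{1,3}$. A red edge of a tree $T$ is an edge $e$ such that each component of $T\setminus\{e\}$ contains a claw. Extended red path $A$: if the red edges of $T$ induce a path $P$, then $A$ is obtained from $P$ by adding, at each endpoint of $P$ that has degree two in $T$, the (non-red) edge of $T$ incident to that endpoint not in $P$ (so $A=P$ if both endpoints of $P$ are branch vertices). If $T$ has no red edge, choose a vertex $v$ whose closed neighbourhood $N[v]$ contains all branch vertices of $T$; if $v$ has degree two with neighbours $u,w$ then $A=uvw$, otherwise $A$ is the single vertex $v$. The vertices of $A$ are called red vertices. -}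

module Defs where

open import Data.Nat using (ℕ; _≤_; _<_)
open import Data.Fin using (Fin)
open import Data.Bool using (Bool; true; false; T; if_then_else_)
open import Data.List using (List; []; _∷_; _++_; [_]; length; allFin; map)
open import Data.Nat.ListAction using (sum)
open import Data.List.Relation.Unary.Unique.Propositional using (Unique)
open import Data.List.Relation.Unary.Linked using (Linked)
open import Data.List.Membership.Propositional using (_∈_)
open import Data.Product using (Σ; ∃; ∃-syntax; _×_)
open import Data.Sum using (_⊎_)
open import Relation.Nullary using (¬_)
open import Relation.Binary.PropositionalEquality using (_≡_; _≢_)
open import Relation.Binary.Construct.Closure.ReflexiveTransitive using (Star)

record Graph (n : ℕ) : Set where
  field
    adj     : Fin n → Fin n → Bool
    symm    : ∀ x y → adj x y ≡ adj y x
    irrefl  : ∀ x → adj x x ≡ false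

module _ {n : ℕ} (G : Graph n) where
  open Graph G

  Adj : Fin n → Fin n → Set
  Adj x y = T (adj x y)

  deg : Fin n → ℕ
  deg v = sum (map (λ u → if adj v u then 1 else 0) (allFin n))

  Branch : Fin n → Set
  Branch v = 2 < deg v

  Connected : Set
  Connected = ∀ x y → Star Adj x y

  -- a cycle: distinct vertices x ∷ xs (at least 3), consecutive adjacent, closing back to x
  Acyclic : Set
  Acyclic = ∀ (x : Fin n) (xs : List (Fin n)) → 2 ≤ length xs →
            Unique (x ∷ xs) → ¬ Linked Adj (x ∷ xs ++ [ x ])

  IsTree : Set
  IsTree = 1 ≤ n × Connected × Acyclic

  AdjMinus : Fin n → Fin n → Fin n → Fin n → Set
  AdjMinus a b x y = Adj x y × ¬ ((x ≡ a × y ≡ b) ⊎ (x ≡ b × y ≡ a))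

  -- the component of s in G - {a,b} contains a claw K_{1,3}
  ClawInComponent : Fin n → Fin n → Fin n → Set
  ClawInComponent a b s =
    ∃[ c ] ∃[ x ] ∃[ y ] ∃[ z ]
      (Star (AdjMinus a b) s c × AdjMinus a b c x × AdjMinus a b c y × AdjMinus a b c z
       × x ≢ y × x ≢ z × y ≢ z)

  Red : Fin n → Fin n → Set
  Red a b = Adj a b × ClawInComponent a b a × ClawInComponent a b b

  Consec : List (Fin n) → Fin n → Fin n → Set
  Consec P x y = ∃[ xs ] ∃[ ys ] (P ≡ xs ++ x ∷ y ∷ ys)

  RedEdgesInducePath : List (Fin n) → Set
  RedEdgesInducePath P =
    2 ≤ length P × Unique P ×
    (∀ x y → Red x y → Consec P x y ⊎ Consec P y x) ×
    (∀ x y → Consec P x y → Red x y)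

  NoRedEdge : Set
  NoRedEdge = ∀ x y → ¬ Red x y

  DominatesBranch : Fin n → Set
  DominatesBranch v = ∀ b → Branch b → b ≡ v ⊎ Adj v b

  EndExt : Fin n → Fin n → List (Fin n) → Set
  EndExt p q E =
    (deg p ≡ 2 × ∃[ u ] (Adj p u × u ≢ q × E ≡ [ u ])) ⊎ (deg p ≢ 2 × E ≡ [])

  -- A (given as its list of vertices, i.e. the red vertices) is an extended red path of G
  IsExtendedRedPath : List (Fin n) → Set
  IsExtendedRedPath A =
    (∃[ P ] ∃[ p₀ ] ∃[ p₁ ] ∃[ rest ] ∃[ mid ] ∃[ q₁ ] ∃[ q₀ ] ∃[ L ] ∃[ R ]
       (RedEdgesInducePath P × P ≡ p₀ ∷ p₁ ∷ rest × P ≡ mid ++ q₁ ∷ q₀ ∷ []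
        × EndExt p₀ p₁ L × EndExt q₀ q₁ R × A ≡ L ++ P ++ R))
    ⊎
    (NoRedEdge × ∃[ v ] (DominatesBranch v ×
       ((deg v ≡ 2 × ∃[ u ] ∃[ w ] (Adj v u × Adj v w × u ≢ w × A ≡ u ∷ v ∷ w ∷ []))
        ⊎ (deg v ≢ 2 × A ≡ [ v ]))))

module Submission where

-- Suppose the red edges induce a path P and a branch vertex b is neither on P nor adjacent to it.
-- Let px be the last edge leaving P on a walk from P to b.  The component of x in T − px contains
-- the claw at b; the component of p contains the component of q in T − pq for a red edge pq of P,
-- hence also a claw.  So px is red and x ∈ P, a contradiction.  Otherwise A contains a vertex whose
-- closed neighbourhood holds every branch vertex.

open import Defs
open import Data.Nat using (ℕ; suc; _<_; _≤_; z≤n; s≤s)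
open import Data.Fin using (Fin; _≟_)
open import Data.Bool using (Bool; true; false; T; if_then_else_)
open import Data.List using (List; []; _∷_; length; allFin; map; filterᵇ; last)
open import Data.Nat.ListAction using (sum)
open import Data.Maybe using (just)
open import Data.Maybe.Properties using (just-injective)
open import Data.Maybe.Relation.Binary.Connected using (just) renaming (Connected to Connectedᴹ)
open import Data.List.Membership.Propositional using (_∈_; _∉_; find; lose)
open import Data.List.Membership.Propositional.Properties using (∈-++⁺ˡ; ∈-++⁺ʳ; ∈-filter⁻)
open import Data.List.Relation.Binary.Subset.Propositional using (_⊆_)
open import Data.List.Relation.Unary.Any using (here; there; any?)
open import Data.List.Relation.Unary.All using (All; []; _∷_) renaming (tabulate to All-tabulate)
open import Data.List.Relation.Unary.All.Properties using (¬Any⇒All¬)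
open import Data.List.Relation.Unary.AllPairs using ([]; _∷_)
open import Data.List.Relation.Unary.Unique.Propositional using (Unique)
open import Data.List.Relation.Unary.Unique.Propositional.Properties using (allFin⁺; filter⁺)
open import Data.List.Relation.Unary.Linked using (Linked; [-]; _∷_)
import Data.List.Relation.Unary.Linked as Linked
open import Data.List.Relation.Unary.Linked.Properties using (++⁺)
open import Data.Product using (∃-syntax; _×_; _,_; proj₁; proj₂; map₂)
open import Data.Sum using (_⊎_; inj₁; inj₂) renaming (map to ⊎-map; swap to ⊎-swap)
open import Data.Empty using (⊥-elim)
open import Function using (_∘_)
open import Relation.Nullary using (¬_; yes; no)
open import Relation.Nullary.Decidable using (T?)
open import Relation.Binary.Definitions using (DecidableEquality)
open import Relation.Binary.PropositionalEquality using (_≡_; _≢_; refl; sym; cong; subst)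
open import Relation.Binary.Construct.Closure.ReflexiveTransitive using (Star; ε; _◅_; _◅◅_)
import Relation.Binary.Construct.Closure.ReflexiveTransitive as Star

sum-indicator≡length-filterᵇ : ∀ {A : Set} (f : A → Bool) xs →
  sum (map (λ x → if f x then 1 else 0) xs) ≡ length (filterᵇ f xs)
sum-indicator≡length-filterᵇ f [] = refl
sum-indicator≡length-filterᵇ f (x ∷ xs) with f x
... | true  = cong suc (sum-indicator≡length-filterᵇ f xs)
... | false = sum-indicator≡length-filterᵇ f xs

three-distinct : ∀ {A : Set} {P : A → Set} {xs} → Unique xs → All P xs → 2 < length xs →
  ∃[ x ] ∃[ y ] ∃[ z ] (P x × P y × P z × x ≢ y × x ≢ z × y ≢ z)
three-distinct {xs = []} _ _ ()
three-distinct {xs = _ ∷ []} _ _ (s≤s ())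
three-distinct {xs = _ ∷ _ ∷ []} _ _ (s≤s (s≤s ()))
three-distinct {xs = x ∷ y ∷ z ∷ _} ((x≢y ∷ x≢z ∷ _) ∷ (y≢z ∷ _) ∷ _) (px ∷ py ∷ pz ∷ _) _ =
  x , y , z , px , py , pz , x≢y , x≢z , y≢z

SimplePath : {A : Set} → (A → A → Set) → A → A → Set
SimplePath R a b = ∃[ ys ] (Linked R (a ∷ ys) × Unique (a ∷ ys) × last (a ∷ ys) ≡ just b)

module _ {A : Set} (_≟ᴬ_ : DecidableEquality A) {R : A → A → Set} where
  open import Data.List.Membership.DecPropositional _≟ᴬ_ using (_∈?_)

  SimplePath-suffix : ∀ {a v vs b} → a ∈ v ∷ vs →
    Linked R (v ∷ vs) → Unique (v ∷ vs) → last (v ∷ vs) ≡ just b → SimplePath R a b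
  SimplePath-suffix {vs = vs} (here refl) linked unique ends = vs , linked , unique , ends
  SimplePath-suffix {vs = _ ∷ _} (there a∈) (_ ∷ linked) (_ ∷ unique) ends =
    SimplePath-suffix a∈ linked unique ends

  Star⇒SimplePath : ∀ {a b} → Star R a b → SimplePath R a b
  Star⇒SimplePath ε = [] , [-] , ([] ∷ []) , refl
  Star⇒SimplePath {a} (_◅_ {j = y} r walk) with Star⇒SimplePath walk
  ... | ys , linked , unique , ends with a ∈? y ∷ ys
  ... | yes a∈ = SimplePath-suffix a∈ linked unique ends
  ... | no a∉ = y ∷ ys , r ∷ linked , ¬Any⇒All¬ (y ∷ ys) a∉ ∷ unique , ends

  Outside : List A → A → A → Set
  Outside S x y = R x y × x ∉ S × y ∉ S

  LastExit : List A → A → Set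
  LastExit S t = ∃[ p ] ∃[ x ] (p ∈ S × x ∉ S × R p x × Star (Outside S) x t)

  exit-or-outside : ∀ {S s t} → t ∉ S → Star R s t → (s ∉ S × Star (Outside S) s t) ⊎ LastExit S t
  exit-or-outside t∉S ε = inj₁ (t∉S , ε)
  exit-or-outside {S} {s} t∉S (r ◅ walk) with exit-or-outside t∉S walk
  ... | inj₂ exit = inj₂ exit
  ... | inj₁ (y∉S , outside) with s ∈? S
  ...   | yes s∈S = inj₂ (s , _ , s∈S , y∉S , r , outside)
  ...   | no s∉S = inj₁ (s∉S , (r , s∉S , y∉S) ◅ outside)

  last-exit : ∀ {S s t} → s ∈ S → t ∉ S → Star R s t → LastExit S t
  last-exit s∈S t∉S walk with exit-or-outside t∉S walk
  ... | inj₁ (s∉S , _) = ⊥-elim (s∉S s∈S)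
  ... | inj₂ exit = exit

module _ {n : ℕ} (G : Graph n) where
  open Graph G
  open import Data.List.Membership.DecPropositional (_≟_ {n}) using (_∈?_)

  Adj-sym : ∀ {x y} → Adj G x y → Adj G y x
  Adj-sym {x} {y} = subst T (symm x y)

  Adj⇒≢ : ∀ {x y} → Adj G x y → x ≢ y
  Adj⇒≢ {x} xx refl = subst T (irrefl x) xx

  branch⇒three-neighbours : ∀ {b} → Branch G b →
    ∃[ y₁ ] ∃[ y₂ ] ∃[ y₃ ] (Adj G b y₁ × Adj G b y₂ × Adj G b y₃ × y₁ ≢ y₂ × y₁ ≢ y₃ × y₂ ≢ y₃)
  branch⇒three-neighbours {b} branch =
    three-distinct (filter⁺ (T? ∘ adj b) (allFin⁺ n))
                   (All-tabulate (proj₂ ∘ ∈-filter⁻ (T? ∘ adj b) {xs = allFin n}))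
                   (subst (2 <_) (sum-indicator≡length-filterᵇ (adj b) (allFin n)) branch)

  AdjMinus-avoiding : ∀ {a b y z} → y ≢ b → z ≢ b → Adj G y z → AdjMinus G a b y z
  AdjMinus-avoiding y≢b z≢b yz = yz , λ { (inj₁ (_ , z≡b)) → z≢b z≡b ; (inj₂ (y≡b , _)) → y≢b y≡b }

  AdjMinus-from-outside : ∀ {a b y z} → y ≢ a → y ≢ b → Adj G y z → AdjMinus G a b y z
  AdjMinus-from-outside y≢a y≢b yz = yz , λ { (inj₁ (y≡a , _)) → y≢a y≡a ; (inj₂ (y≡b , _)) → y≢b y≡b }

  AdjMinus-swap : ∀ {a b y z} → AdjMinus G a b y z → AdjMinus G b a y z
  AdjMinus-swap (yz , ¬removed) = yz , ¬removed ∘ ⊎-swap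

  ClawInComponent-swap : ∀ {a b s} → ClawInComponent G a b s → ClawInComponent G b a s
  ClawInComponent-swap (c , x , y , z , s⇝c , cx , cy , cz , distinct) =
    c , x , y , z , Star.map AdjMinus-swap s⇝c , AdjMinus-swap cx , AdjMinus-swap cy , AdjMinus-swap cz , distinct

  Red-sym : ∀ {a b} → Red G a b → Red G b a
  Red-sym (ab , claw-a , claw-b) = Adj-sym ab , ClawInComponent-swap claw-b , ClawInComponent-swap claw-a

  Acyclic⇒no-detour : Acyclic G → ∀ {p q} → Adj G p q → ¬ Star (AdjMinus G p q) q p
  Acyclic⇒no-detour acyclic {p} {q} pq detour with Star⇒SimplePath _≟_ detour
  ... | [] , _ , _ , q≡p = Adj⇒≢ pq (sym (just-injective q≡p))
  ... | _ ∷ [] , (qy ∷ _) , _ , y≡p = proj₂ qy (inj₂ (refl , just-injective y≡p))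
  ... | y ∷ z ∷ zs , linked , unique , ends =
    acyclic q (y ∷ z ∷ zs) (s≤s (s≤s z≤n)) unique
      (++⁺ (Linked.map proj₁ linked) (subst (λ e → Connectedᴹ (Adj G) e (just q)) (sym ends) (just pq)) [-])

  branch⇒ClawInComponent : ∀ {a c s b} → Branch G b → b ≢ a → b ≢ c →
    Star (AdjMinus G a c) s b → ClawInComponent G a c s
  branch⇒ClawInComponent branch b≢a b≢c s⇝b with branch⇒three-neighbours branch
  ... | y₁ , y₂ , y₃ , by₁ , by₂ , by₃ , distinct =
    _ , y₁ , y₂ , y₃ , s⇝b , edge by₁ , edge by₂ , edge by₃ , distinct
    where
      edge : ∀ {y} → Adj G _ y → AdjMinus G _ _ _ y
      edge = AdjMinus-from-outside b≢a b≢c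

  -- The component of q in T − pq avoids p, so it lies inside the component of p in T − xp.
  ClawInComponent-transfer : Acyclic G → ∀ {x p q} → Adj G p q → q ≢ x →
    ClawInComponent G p q q → ClawInComponent G x p p
  ClawInComponent-transfer acyclic {x} {p} {q} pq q≢x (c , y₁ , y₂ , y₃ , q⇝c , cy₁ , cy₂ , cy₃ , distinct) =
    c , y₁ , y₂ , y₃ , pq′ ◅ reroute ε q⇝c , move q⇝c cy₁ , move q⇝c cy₂ , move q⇝c cy₃ , distinct
    where
      avoids-p : ∀ {s} → Star (AdjMinus G p q) q s → s ≢ p
      avoids-p q⇝p refl = Acyclic⇒no-detour acyclic pq q⇝p

      move : ∀ {s t} → Star (AdjMinus G p q) q s → AdjMinus G p q s t → AdjMinus G x p s t
      move q⇝s st = AdjMinus-avoiding (avoids-p q⇝s) (avoids-p (q⇝s ◅◅ st ◅ ε)) (proj₁ st)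

      reroute : ∀ {s t} → Star (AdjMinus G p q) q s → Star (AdjMinus G p q) s t → Star (AdjMinus G x p) s t
      reroute _ ε = ε
      reroute q⇝s (st ◅ t⇝) = move q⇝s st ◅ reroute (q⇝s ◅◅ st ◅ ε) t⇝

      pq′ : AdjMinus G x p p q
      pq′ = pq , λ { (inj₁ (_ , q≡p)) → Adj⇒≢ pq (sym q≡p) ; (inj₂ (_ , q≡x)) → q≢x q≡x }

  Consec⇒∈ : ∀ {P x y} → Consec G P x y → x ∈ P × y ∈ P
  Consec⇒∈ (xs , _ , refl) = ∈-++⁺ʳ xs (here refl) , ∈-++⁺ʳ xs (there (here refl))

  Consec-∷ : ∀ {a P x y} → Consec G P x y → Consec G (a ∷ P) x y
  Consec-∷ {a} (xs , ys , eq) = a ∷ xs , ys , cong (a ∷_) eq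

  Consec-neighbour : ∀ {P p} → 2 ≤ length P → p ∈ P → ∃[ q ] (Consec G P p q ⊎ Consec G P q p)
  Consec-neighbour {_ ∷ []} (s≤s ()) _
  Consec-neighbour {_ ∷ _ ∷ rest} _ (here refl) = _ , inj₁ ([] , rest , refl)
  Consec-neighbour {_ ∷ _ ∷ rest} _ (there (here refl)) = _ , inj₂ ([] , rest , refl)
  Consec-neighbour {_ ∷ _ ∷ _ ∷ _} _ (there (there p∈)) =
    map₂ (⊎-map Consec-∷ Consec-∷) (Consec-neighbour (s≤s (s≤s z≤n)) (there p∈))

  red⇒on-path : ∀ {P x y} → RedEdgesInducePath G P → Red G x y → x ∈ P
  red⇒on-path (_ , _ , red⇒consec , _) xy with red⇒consec _ _ xy
  ... | inj₁ consec = proj₁ (Consec⇒∈ consec)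
  ... | inj₂ consec = proj₂ (Consec⇒∈ consec)

  on-path⇒red : ∀ {P p} → RedEdgesInducePath G P → p ∈ P → ∃[ q ] (q ∈ P × Red G p q)
  on-path⇒red (two≤ , _ , _ , consec⇒red) p∈ with Consec-neighbour two≤ p∈
  ... | q , inj₁ consec = q , proj₂ (Consec⇒∈ consec) , consec⇒red _ _ consec
  ... | q , inj₂ consec = q , proj₁ (Consec⇒∈ consec) , Red-sym (consec⇒red _ _ consec)

  Dominates : List (Fin n) → Fin n → Set
  Dominates xs b = b ∈ xs ⊎ ∃[ a ] (a ∈ xs × Adj G a b)

  Dominates-mono : ∀ {xs ys b} → xs ⊆ ys → Dominates xs b → Dominates ys b
  Dominates-mono xs⊆ys (inj₁ b∈) = inj₁ (xs⊆ys b∈)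
  Dominates-mono xs⊆ys (inj₂ (a , a∈ , ab)) = inj₂ (a , xs⊆ys a∈ , ab)

  DominatesBranch⇒Dominates : ∀ {v xs b} → DominatesBranch G v → v ∈ xs → Branch G b → Dominates xs b
  DominatesBranch⇒Dominates dominates v∈ branch with dominates _ branch
  ... | inj₁ refl = inj₁ v∈
  ... | inj₂ vb = inj₂ (_ , v∈ , vb)

  red-path-dominates-branch : IsTree G → ∀ {P b} → RedEdgesInducePath G P → Branch G b → Dominates P b
  red-path-dominates-branch _ {[]} (() , _) _
  red-path-dominates-branch (_ , connected , acyclic) {p₀ ∷ P} {b} induced branch
    with b ∈? p₀ ∷ P | any? (λ a → T? (adj a b)) (p₀ ∷ P)
  ... | yes b∈ | _ = inj₁ b∈
  ... | no _ | yes adjacent = inj₂ (find adjacent)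
  ... | no b∉ | no ¬adjacent with last-exit _≟_ (here refl) b∉ (connected p₀ b)
  ...   | p , x , p∈ , x∉ , px , x⇝b = ⊥-elim (x∉ (red⇒on-path induced (Adj-sym px , claw-x , claw-p)))
    where
      ∉⇒≢p : ∀ {y} → y ∉ p₀ ∷ P → y ≢ p
      ∉⇒≢p y∉ refl = y∉ p∈

      claw-x : ClawInComponent G x p x
      claw-x = branch⇒ClawInComponent branch (λ { refl → ¬adjacent (lose p∈ px) }) (∉⇒≢p b∉)
                 (Star.map (λ (yz , y∉ , z∉) → AdjMinus-avoiding (∉⇒≢p y∉) (∉⇒≢p z∉) yz) x⇝b)

      claw-p : ClawInComponent G x p p
      claw-p with on-path⇒red induced p∈
      ... | q , q∈ , (pq , _ , claw-q) =
        ClawInComponent-transfer acyclic pq (λ { refl → x∉ q∈ }) claw-q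

-- The case hypothesis is not needed: the shape of A already carries the induced path or the
-- dominating vertex.
lemma5 : ∀ {n : ℕ} (G : Graph n) → IsTree G →
         ((∃[ P ] RedEdgesInducePath G P) ⊎ (NoRedEdge G × ∃[ v ] DominatesBranch G v)) →
         ∀ (A : List (Fin n)) → IsExtendedRedPath G A →
         ∀ b → Branch G b → b ∈ A ⊎ (∃[ a ] (a ∈ A × Adj G a b))
lemma5 G tree _ _ (inj₁ (P , _ , _ , _ , _ , _ , _ , L , _ , induced , _ , _ , _ , _ , refl)) _ branch =
  Dominates-mono G (∈-++⁺ʳ L ∘ ∈-++⁺ˡ) (red-path-dominates-branch G tree induced branch)
lemma5 G _ _ _ (inj₂ (_ , _ , dominates , inj₁ (_ , _ , _ , _ , _ , _ , refl))) _ branch =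
  DominatesBranch⇒Dominates G dominates (there (here refl)) branch
lemma5 G _ _ _ (inj₂ (_ , _ , dominates , inj₂ (_ , refl))) _ branch =
  DominatesBranch⇒Dominates G dominates (here refl) branch
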